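{- Let $p \geq 1$ and $q \in \{2,3\}$ be integers. Then $\zeta(C_{2p+1} \square C_{2q}) = 2$.
   Context: The localization game on a connected graph $G$ is played by a Cop controlling $k$ cops and a Robber. The Robber first chooses a vertex $r$, unknown to the Cop. In each turn the Cop probes a set $B=\{b_1,\dots,b_k\}$ of $k$ vertices and receives the distance vector $[d_G(r,b_1),\dots,d_G(r,b_k)]$. If the Cop can determine $r$ exactly, the Cop wins; otherwise the Robber may stay at $r$ or move to a neighbour of $r$, and the next turn begins. The Cop wins if the Robber is located after finitely many turns. The localization number $\zeta(G)$ is the least positive integer $k$ such that the Cop has a winning strategy with $k$ cops. $C_n$ is the cycle of order $n$ and $\square$ the Cartesian product. -}

module Defs where

open import Data.Nat using (ℕ; zero; suc; _≤_; _<_)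
open import Data.Nat.Properties using () renaming (_≟_ to _≟ℕ_)
open import Data.Fin using (Fin; toℕ)
open import Data.Fin.Properties using () renaming (_≟_ to _≟F_)
open import Data.Bool using (Bool; true; false; _∨_; _∧_; if_then_else_)
open import Data.Bool.ListAction using (any)
open import Data.List using (List; []; _∷_; length; allFin; cartesianProduct)
open import Data.List.Membership.Propositional using (_∈_)
open import Data.List.Membership.Propositional.Properties using (∈-allFin; ∈-cartesianProduct⁺)
open import Data.Vec using (Vec)
import Data.Vec as Vec
open import Data.Product using (Σ; ∃; _×_; _,_; proj₁; proj₂)
open import Data.Product.Properties using (≡-dec)
open import Data.Sum using (_⊎_; inj₁; inj₂)
open import Relation.Nullary using (Dec; ¬_; ⌊_⌋)
open import Relation.Nullary.Decidable using (_⊎-dec_; _×-dec_)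
open import Relation.Binary.PropositionalEquality using (_≡_)
open import Relation.Binary.Definitions using (DecidableEquality)

record Graph : Set₁ where
  field
    V        : Set
    _≟V_     : DecidableEquality V
    verts    : List V
    complete : ∀ v → v ∈ verts
    Adj      : V → V → Set
    adj?     : ∀ u v → Dec (Adj u v)

open Graph public

reach : (G : Graph) → ℕ → V G → V G → Bool
reach G zero    u v = ⌊ (_≟V_ G) u v ⌋
reach G (suc k) u v =
  reach G k u v ∨ any (λ w → reach G k u w ∧ ⌊ adj? G w v ⌋) (verts G)

least : ℕ → (ℕ → Bool) → ℕ → ℕ
least zero    f k = k
least (suc n) f k = if f k then k else least n f (suc k)

-- graph distance d_G(u,v): the least k with a walk of length ≤ k from u to v
-- (every shortest path has length < |V|, so |V| steps of search suffice in a
-- connected graph).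
dist : (G : Graph) → V G → V G → ℕ
dist G u v = least (length (verts G)) (λ k → reach G k u v) 0

CSucc : (m : ℕ) → Fin m → Fin m → Set
CSucc m i j = (suc (toℕ i) ≡ toℕ j) ⊎ ((suc (toℕ i) ≡ m) × (toℕ j ≡ 0))

CSucc? : (m : ℕ) → ∀ i j → Dec (CSucc m i j)
CSucc? m i j = (suc (toℕ i) ≟ℕ toℕ j) ⊎-dec ((suc (toℕ i) ≟ℕ m) ×-dec (toℕ j ≟ℕ 0))

Cycle : ℕ → Graph
Cycle m = record
  { V = Fin m
  ; _≟V_ = _≟F_
  ; verts = allFin m
  ; complete = ∈-allFin
  ; Adj = λ i j → CSucc m i j ⊎ CSucc m j i
  ; adj? = λ i j → CSucc? m i j ⊎-dec CSucc? m j i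
  }

_□_ : Graph → Graph → Graph
G □ H = record
  { V = V G × V H
  ; _≟V_ = ≡-dec (_≟V_ G) (_≟V_ H)
  ; verts = cartesianProduct (verts G) (verts H)
  ; complete = λ { (a , b) → ∈-cartesianProduct⁺ (complete G a) (complete H b) }
  ; Adj = λ { (a , b) (a' , b') → (Adj G a a' × b ≡ b') ⊎ (a ≡ a' × Adj H b b') }
  ; adj? = λ { (a , b) (a' , b') →
       (adj? G a a' ×-dec (_≟V_ H) b b') ⊎-dec ((_≟V_ G) a a' ×-dec adj? H b b') }
  }

-- A Cop strategy with k cops: given the list of distance vectors received
-- in the previous turns (most recent first), choose the k probed vertices.
Strategy : Graph → ℕ → Set
Strategy G k = List (Vec ℕ k) → Vec (V G) k

Trajectory : Graph → Set
Trajectory G = Σ (ℕ → V G) λ r → ∀ t → (r (suc t) ≡ r t) ⊎ Adj G (r t) (r (suc t))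

history : (G : Graph) {k : ℕ} → Strategy G k → (ℕ → V G) → ℕ → List (Vec ℕ k)
history G σ r zero    = []
history G σ r (suc t) = Vec.map (dist G (r t)) (σ (history G σ r t)) ∷ history G σ r t

-- After the probe of turn t the Cop can determine the Robber's position:
-- every Robber trajectory yielding the same answers in turns 0..t is at the
-- same vertex in turn t.
Located : (G : Graph) {k : ℕ} → Strategy G k → Trajectory G → ℕ → Set
Located G σ r t = (r' : Trajectory G) →
  history G σ (proj₁ r') (suc t) ≡ history G σ (proj₁ r) (suc t) →
  proj₁ r' t ≡ proj₁ r t

CopWins : Graph → ℕ → Set
CopWins G k = Σ (Strategy G k) λ σ → (r : Trajectory G) → ∃ λ t → Located G σ r t

LocalizationNumberIs : Graph → ℕ → Set
LocalizationNumberIs G n = CopWins G n × (∀ k → 1 ≤ k → k < n → ¬ CopWins G k)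

-- Lower bound: distances change by at most one along an edge, so a vertex of
-- the torus and three of its neighbours, four vertices, give at most three
-- answers to a single probe. Hence the Robber can always move to one of two
-- vertices that the probe cannot tell apart, and one cop never locates him.
--
-- Upper bound: the distance in C (2p + 1) □ C m is the sum of the distances in
-- the two cycles. Probes at (0 , 0) and (p , 0) give the Robber's column a and
-- the distance β of its row from row 0: the two answers add up to p or p + 1,
-- according to the side of p on which a lies, plus 2β, so parity decides.
-- After the Robber's move, probes at (a + p , 0) and (a + p + 1 , 1) locate
-- him; for m = 4 and m = 6 this last step is a finite check.
module Submission where

open import Defs
open import Data.Bool using (Bool; true; false; T)
open import Data.Bool.Properties using (T-∨; T-∧)
open import Data.Fin using (Fin; toℕ; fromℕ<; fromℕ; inject₁; zero; suc)
open import Data.Fin.Properties using (toℕ-injective; toℕ<n; toℕ-fromℕ<; toℕ-fromℕ; toℕ-inject₁; all?)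
  renaming (_≟_ to _≟ᶠ_)
open import Data.List using (List; []; _∷_; length; map; cartesianProduct; allFin)
open import Data.List.Membership.Propositional using (lose)
import Data.List.Properties as List
open import Data.List.Relation.Unary.Any using (any?; satisfied)
open import Data.List.Relation.Unary.Any.Properties using (any⁺; any⁻)
open import Data.Nat using (ℕ; zero; suc; pred; _+_; _*_; _∸_; _⊓_; _≤_; _<_; z≤n; s≤s; ∣_-_∣; _≤?_; _<?_)
open import Data.Nat.Properties
open import Data.Nat.Tactic.RingSolver using (solve-∀)
open import Data.Product using (∃-syntax; _×_; _,_; proj₁; proj₂; swap)
open import Data.Sum using (_⊎_; inj₁; inj₂)
import Data.Sum as Sum
open import Data.Unit using (tt)
open import Data.Vec using (Vec; []; _∷_; head)
import Data.Vec as Vec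
import Data.Vec.Properties as Vec
open import Function using (_∘_; Equivalence)
open import Relation.Binary.Definitions using (DecidableEquality; tri<; tri≈; tri>)
open import Relation.Binary.PropositionalEquality
  using (_≡_; _≢_; refl; sym; trans; cong; cong₂; subst; subst₂; module ≡-Reasoning)
open import Relation.Nullary using (Dec; yes; no; ¬_; contradiction)
open import Relation.Nullary.Decidable using (_×-dec_; _⊎-dec_; _→-dec_; toWitness; fromWitness)

open Equivalence using (to; from)
open ≡-Reasoning

least-characterisation : ∀ (f : ℕ → Bool) n k j → k ≤ j → j < k + n → T (f j) →
  (∀ i → k ≤ i → i < j → ¬ T (f i)) → least n f k ≡ j
least-characterisation f zero k j k≤j j<k+0 _ _ =
  contradiction (subst (j <_) (+-identityʳ k) j<k+0) (≤⇒≯ k≤j)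
least-characterisation f (suc n) k j k≤j j<k+n fj below with f k in fk | k ≟ j
... | true  | yes k≡j = k≡j
... | true  | no  k≢j = contradiction (subst T (sym fk) tt) (below k ≤-refl (≤∧≢⇒< k≤j k≢j))
... | false | yes refl = contradiction (subst T fk fj) λ ()
... | false | no  k≢j = least-characterisation f n (suc k) j (≤∧≢⇒< k≤j k≢j)
  (subst (j <_) (+-suc k n) j<k+n) fj (λ i k<i i<j → below i (<⇒≤ k<i) i<j)

module _ (G : Graph) (u : V G) (g : V G → ℕ)
         (g-zero : ∀ v → g v ≡ 0 → u ≡ v)
         (g-root : g u ≡ 0)
         (g-step : ∀ {w v} → Adj G w v → g v ≤ suc (g w))
         (g-parent : ∀ v k → g v ≡ suc k → ∃[ w ] Adj G w v × g w ≡ k)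
         (g-bound : ∀ v → g v < length (verts G)) where

  reach⇒label≤ : ∀ k v → T (reach G k u v) → g v ≤ k
  reach⇒label≤ zero v r with toWitness r
  ... | refl = ≤-reflexive g-root
  reach⇒label≤ (suc k) v r with to T-∨ r
  ... | inj₁ r′ = m≤n⇒m≤1+n (reach⇒label≤ k v r′)
  ... | inj₂ r′ with satisfied (any⁻ _ (verts G) r′)
  ... | w , rw with to T-∧ rw
  ... | r″ , w~v = ≤-trans (g-step (toWitness w~v)) (s≤s (reach⇒label≤ k w r″))

  label⇒reach : ∀ k v → g v ≡ k → T (reach G k u v)
  label⇒reach zero v gv≡0 with g-zero v gv≡0
  ... | refl = fromWitness refl
  label⇒reach (suc k) v gv≡1+k with g-parent v k gv≡1+k
  ... | w , w~v , gw≡k = from T-∨ (inj₂ (any⁺ _ (lose (complete G w)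
          (from T-∧ (label⇒reach k w gw≡k , fromWitness w~v)))))

  dist≡label : ∀ v → dist G u v ≡ g v
  dist≡label v = least-characterisation (λ k → reach G k u v) (length (verts G)) 0 (g v)
    z≤n (g-bound v) (label⇒reach (g v) v refl)
    (λ i _ i<gv r → <⇒≱ i<gv (reach⇒label≤ i v r))

∣m-1+n∣-consecutive : ∀ m n → ∣ m - suc n ∣ ≡ suc ∣ m - n ∣ ⊎ ∣ m - n ∣ ≡ suc ∣ m - suc n ∣
∣m-1+n∣-consecutive zero    n       = inj₁ refl
∣m-1+n∣-consecutive (suc m) zero    = inj₂ (cong suc (sym (∣-∣-identityʳ m)))
∣m-1+n∣-consecutive (suc m) (suc n) = ∣m-1+n∣-consecutive m n

m∸n≤1+m∸[1+n] : ∀ m n → m ∸ n ≤ suc (m ∸ suc n)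
m∸n≤1+m∸[1+n] zero    zero    = z≤n
m∸n≤1+m∸[1+n] zero    (suc n) = z≤n
m∸n≤1+m∸[1+n] (suc m) zero    = ≤-refl
m∸n≤1+m∸[1+n] (suc m) (suc n) = m∸n≤1+m∸[1+n] m n

-- Vertices x and y of Cycle n are at distance arc n ∣ x - y ∣ (see dist-torus).
arc : ℕ → ℕ → ℕ
arc n d = d ⊓ (n ∸ d)

-- CSucc n i j unfolds to CycSucc n (toℕ i) (toℕ j).
CycSucc : ℕ → ℕ → ℕ → Set
CycSucc n y y′ = suc y ≡ y′ ⊎ (suc y ≡ n × y′ ≡ 0)

module _ (n : ℕ) where

  arc-short : ∀ {d} → d ≤ n ∸ d → arc n d ≡ d
  arc-short = m≤n⇒m⊓n≡m

  arc-long : ∀ {d} → n ∸ d ≤ d → arc n d ≡ n ∸ d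
  arc-long = m≥n⇒m⊓n≡n

  arc≤ : ∀ d → arc n d ≤ d
  arc≤ d = m⊓n≤m d (n ∸ d)

  arc-complement : ∀ {d} → d ≤ n → arc n (n ∸ d) ≡ arc n d
  arc-complement {d} d≤n = begin
    (n ∸ d) ⊓ (n ∸ (n ∸ d)) ≡⟨ cong ((n ∸ d) ⊓_) (m∸[m∸n]≡n d≤n) ⟩
    (n ∸ d) ⊓ d             ≡⟨ ⊓-comm (n ∸ d) d ⟩
    d ⊓ (n ∸ d)             ∎

  arc-consecutive : ∀ {a b} → a ≡ suc b ⊎ b ≡ suc a →
    arc n a ≤ suc (arc n b) × arc n b ≤ suc (arc n a)
  arc-consecutive (inj₁ refl) =
    ⊓-mono-≤ ≤-refl (≤-trans (∸-monoʳ-≤ n (n≤1+n _)) (n≤1+n _)) ,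
    ⊓-mono-≤ (m≤n⇒m≤1+n (n≤1+n _)) (m∸n≤1+m∸[1+n] n _)
  arc-consecutive (inj₂ refl) = swap (arc-consecutive (inj₁ refl))

  arc-CycSucc : ∀ x {y y′} → x < n → CycSucc n y y′ →
    arc n ∣ x - y′ ∣ ≤ suc (arc n ∣ x - y ∣) × arc n ∣ x - y ∣ ≤ suc (arc n ∣ x - y′ ∣)
  arc-CycSucc x {y} _ (inj₁ refl) with ∣m-1+n∣-consecutive x y
  ... | inj₁ e = arc-consecutive (inj₁ e)
  ... | inj₂ e = arc-consecutive (inj₂ e)
  arc-CycSucc x {y} x<n (inj₂ (1+y≡n , refl)) =
    subst (λ a → arc n ∣ x - 0 ∣ ≤ suc a × a ≤ suc (arc n ∣ x - 0 ∣)) wrap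
      (subst (λ d → arc n d ≤ suc (arc n (suc x)) × arc n (suc x) ≤ suc (arc n d))
        (sym (∣-∣-identityʳ x)) (arc-consecutive (inj₂ refl)))
    where
      x≤y : x ≤ y
      x≤y = ≤-pred (subst (x <_) (sym 1+y≡n) x<n)
      -- x + 1 and y - x add up to n.
      wrap : arc n (suc x) ≡ arc n ∣ x - y ∣
      wrap = begin
        arc n (suc x)                 ≡⟨ cong (arc n) (sym (m∸[m∸n]≡n (s≤s x≤y))) ⟩
        arc n (suc y ∸ (suc y ∸ suc x)) ≡⟨ cong (λ m → arc n (m ∸ (y ∸ x))) 1+y≡n ⟩
        arc n (n ∸ (y ∸ x))           ≡⟨ arc-complement (≤-trans (m∸n≤m y x) (≤-trans (n≤1+n y) (≤-reflexive 1+y≡n))) ⟩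
        arc n (y ∸ x)                 ≡⟨ cong (arc n) (sym (m≤n⇒∣m-n∣≡n∸m x≤y)) ⟩
        arc n ∣ x - y ∣               ∎

n≡m+o⇒∣m-n∣≡o : ∀ {m n o} → n ≡ m + o → ∣ m - n ∣ ≡ o
n≡m+o⇒∣m-n∣≡o {m} {o = o} refl = ∣m-m+n∣≡n m o

m≡n+o⇒∣m-n∣≡o : ∀ {m n o} → m ≡ n + o → ∣ m - n ∣ ≡ o
m≡n+o⇒∣m-n∣≡o {m} {n} m≡n+o = trans (∣-∣-comm m n) (n≡m+o⇒∣m-n∣≡o m≡n+o)

2+[m+n]≡m+[2+n] : ∀ m n → suc (suc (m + n)) ≡ m + suc (suc n)
2+[m+n]≡m+[2+n] m n = sym (trans (+-suc m (suc n)) (cong suc (+-suc m n)))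

module _ (n : ℕ) where

  CloserNeighbour : ℕ → ℕ → ℕ → Set
  CloserNeighbour x y k = ∃[ y′ ] y′ < n × (CycSucc n y′ y ⊎ CycSucc n y y′) × arc n ∣ x - y′ ∣ ≡ k

  private
    arc-toward : ∀ {e k} → suc e ≤ n ∸ suc e → arc n (suc e) ≡ suc k → arc n e ≡ k
    arc-toward {e} short arc≡1+k = trans (arc-short n e≤n∸e) (suc-injective (trans (sym (arc-short n short)) arc≡1+k))
      where
        e≤n∸e : e ≤ n ∸ e
        e≤n∸e = ≤-trans (n≤1+n e) (≤-trans short (∸-monoʳ-≤ n (n≤1+n e)))

    arc-away : ∀ {e k} → n ∸ suc e < suc e → arc n (suc e) ≡ suc k → arc n (suc (suc e)) ≡ k
    arc-away {e} {k} long arc≡1+k = begin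
      arc n (suc (suc e))    ≡⟨ arc-long n (≤-trans (∸-monoʳ-≤ n (n≤1+n (suc e))) (m≤n⇒m≤1+n (<⇒≤ long))) ⟩
      n ∸ suc (suc e)        ≡⟨ pred[m∸n]≡m∸[1+n] n (suc e) ⟨
      pred (n ∸ suc e)       ≡⟨ cong pred (trans (sym (arc-long n (<⇒≤ long))) arc≡1+k) ⟩
      k                      ∎

  closer-from-below : ∀ x e {k} → suc (x + e) < n → arc n (suc e) ≡ suc k → CloserNeighbour x (suc (x + e)) k
  closer-from-below x e {k} y<n arc≡1+k with suc e ≤? n ∸ suc e | suc (suc (x + e)) <? n
  ... | yes short | _ =
    x + e , <-trans (n<1+n _) y<n , inj₁ (inj₁ refl) ,
    trans (cong (arc n) (∣m-m+n∣≡n x e)) (arc-toward short arc≡1+k)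
  ... | no long | yes 1+y<n =
    suc (suc (x + e)) , 1+y<n , inj₂ (inj₁ refl) ,
    trans (cong (arc n) (n≡m+o⇒∣m-n∣≡o (2+[m+n]≡m+[2+n] x e))) (arc-away (≰⇒> long) arc≡1+k)
  ... | no long | no 1+y≮n = 0 , ≤-trans (s≤s z≤n) y<n , inj₂ (inj₂ (y+1≡n , refl)) , (begin
      arc n ∣ x - 0 ∣         ≡⟨ cong (arc n) (∣-∣-identityʳ x) ⟩
      arc n x                 ≡⟨ arc-complement n x≤n ⟨
      arc n (n ∸ x)           ≡⟨ cong (arc n) n∸x ⟩
      arc n (suc (suc e))     ≡⟨ arc-away (≰⇒> long) arc≡1+k ⟩
      k                       ∎)
    where
      y+1≡n : suc (suc (x + e)) ≡ n
      y+1≡n = ≤-antisym y<n (≮⇒≥ 1+y≮n)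
      n∸x : n ∸ x ≡ suc (suc e)
      n∸x = trans (cong (_∸ x) (trans (sym y+1≡n) (2+[m+n]≡m+[2+n] x e))) (m+n∸m≡n x _)
      x≤n : x ≤ n
      x≤n = ≤-trans (m≤m+n x e) (<⇒≤ (<-trans (n<1+n _) y<n))

  closer-from-above : ∀ y e {k} → suc (y + e) < n → arc n (suc e) ≡ suc k → CloserNeighbour (suc (y + e)) y k
  closer-from-above y e {k} x<n arc≡1+k with suc e ≤? n ∸ suc e
  ... | yes short =
    suc y , ≤-trans (s≤s (s≤s (m≤m+n y e))) x<n , inj₂ (inj₁ refl) ,
    trans (cong (arc n) (m≡n+o⇒∣m-n∣≡o {suc y + e} {suc y} refl)) (arc-toward short arc≡1+k)
  ... | no long = away y x<n
    where
      away : ∀ y → suc (y + e) < n → CloserNeighbour (suc (y + e)) y k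
      away (suc y₀) x<n =
        y₀ , ≤-trans (m≤n⇒m≤1+n (m≤m+n (suc y₀) e)) (<⇒≤ x<n) , inj₁ (inj₁ refl) ,
        trans (cong (arc n) (m≡n+o⇒∣m-n∣≡o {n = y₀} (2+[m+n]≡m+[2+n] y₀ e))) (arc-away (≰⇒> long) arc≡1+k)
      away zero x<n = n ∸ 1 , ∸-monoʳ-< ≤-refl 1≤n , inj₁ (inj₂ (m+[n∸m]≡n 1≤n , refl)) , (begin
        arc n ∣ suc e - (n ∸ 1) ∣
          ≡⟨ cong (arc n) (m≤n⇒∣m-n∣≡n∸m (m+n≤o⇒m≤o∸n (suc e) (subst (_≤ n) (+-comm 1 (suc e)) x<n))) ⟩
        arc n (n ∸ 1 ∸ suc e)      ≡⟨ cong (arc n) (∸-+-assoc n 1 (suc e)) ⟩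
        arc n (n ∸ suc (suc e))    ≡⟨ arc-complement n x<n ⟩
        arc n (suc (suc e))        ≡⟨ arc-away (≰⇒> long) arc≡1+k ⟩
        k                          ∎)
        where
          1≤n : 1 ≤ n
          1≤n = ≤-trans (s≤s z≤n) x<n

  arc-predecessor : ∀ {x y k} → x < n → y < n → arc n ∣ x - y ∣ ≡ suc k → CloserNeighbour x y k
  arc-predecessor {x} {y} x<n y<n arc≡1+k with <-cmp x y
  ... | tri≈ _ refl _ = contradiction (trans (cong (arc n) (sym (∣n-n∣≡0 x))) arc≡1+k) λ ()
  ... | tri< x<y _ _ with m≤n⇒∃[o]m+o≡n x<y
  ...   | e , refl =
    closer-from-below x e y<n (trans (cong (arc n) (sym (n≡m+o⇒∣m-n∣≡o (sym (+-suc x e))))) arc≡1+k)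
  arc-predecessor {x} {y} x<n y<n arc≡1+k | tri> _ _ y<x with m≤n⇒∃[o]m+o≡n y<x
  ...   | e , refl =
    closer-from-above y e x<n (trans (cong (arc n) (sym (m≡n+o⇒∣m-n∣≡o (sym (+-suc y e))))) arc≡1+k)

cycDist : ∀ {n} → Fin n → Fin n → ℕ
cycDist {n} i j = arc n ∣ toℕ i - toℕ j ∣

cycDist-sym : ∀ {n} (i j : Fin n) → cycDist i j ≡ cycDist j i
cycDist-sym {n} i j = cong (arc n) (∣-∣-comm (toℕ i) (toℕ j))

cycDist-self : ∀ {n} (i : Fin n) → cycDist i i ≡ 0
cycDist-self {n} i = cong (arc n) (∣n-n∣≡0 (toℕ i))

∣i-j∣<n : ∀ {n} (i j : Fin n) → ∣ toℕ i - toℕ j ∣ < n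
∣i-j∣<n i j = ≤-<-trans (∣m-n∣≤m⊔n (toℕ i) (toℕ j)) (⊔-lub (toℕ<n i) (toℕ<n j))

cycDist< : ∀ {n} (i j : Fin n) → cycDist i j < n
cycDist< {n} i j = ≤-<-trans (arc≤ n _) (∣i-j∣<n i j)

cycDist≡0⇒≡ : ∀ {n} (i j : Fin n) → cycDist i j ≡ 0 → i ≡ j
cycDist≡0⇒≡ {n} i j d≡0 = toℕ-injective (∣m-n∣≡0⇒m≡n (arc≡0 _ (∣i-j∣<n i j) d≡0))
  where
    arc≡0 : ∀ d → d < n → arc n d ≡ 0 → d ≡ 0
    arc≡0 zero    _   _ = refl
    arc≡0 (suc d) d<n arc≡0 with ⊓-sel (suc d) (n ∸ suc d)
    ... | inj₁ ⊓≡ with () ← trans (sym ⊓≡) arc≡0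
    ... | inj₂ ⊓≡ = contradiction (m∸n≡0⇒m≤n (trans (sym ⊓≡) arc≡0)) (<⇒≱ d<n)

cycDist-step : ∀ {n} i {w v : Fin n} → Adj (Cycle n) w v → cycDist i v ≤ suc (cycDist i w)
cycDist-step {n} i (inj₁ w→v) = proj₁ (arc-CycSucc n (toℕ i) (toℕ<n i) w→v)
cycDist-step {n} i (inj₂ v→w) = proj₂ (arc-CycSucc n (toℕ i) (toℕ<n i) v→w)

cycDist-parent : ∀ {n} i (v : Fin n) k → cycDist i v ≡ suc k → ∃[ w ] Adj (Cycle n) w v × cycDist i w ≡ k
cycDist-parent {n} i v k d≡1+k with arc-predecessor n (toℕ<n i) (toℕ<n v) d≡1+k
... | y , y<n , y~v , arc≡k =
  fromℕ< y<n ,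
  subst (λ z → CycSucc n z (toℕ v) ⊎ CycSucc n (toℕ v) z) (sym (toℕ-fromℕ< y<n)) y~v ,
  subst (λ z → arc n ∣ toℕ i - z ∣ ≡ k) (sym (toℕ-fromℕ< y<n)) arc≡k

Torus : ℕ → ℕ → Graph
Torus n m = Cycle n □ Cycle m

torusDist : ∀ {n m} → Fin n × Fin m → Fin n × Fin m → ℕ
torusDist (a , b) (c , d) = cycDist a c + cycDist b d

length-cartesianProduct : ∀ {A B : Set} (xs : List A) (ys : List B) →
  length (cartesianProduct xs ys) ≡ length xs * length ys
length-cartesianProduct []       ys = refl
length-cartesianProduct (x ∷ xs) ys = trans (List.length-++ (map (x ,_) ys))
  (cong₂ _+_ (List.length-map (x ,_) ys) (length-cartesianProduct xs ys))

m<n⇒o<p⇒m+o<n*p : ∀ {m n o p} → m < n → o < p → m + o < n * p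
m<n⇒o<p⇒m+o<n*p {m} {suc n} {o} {suc p} (s≤s m≤n) (s≤s o≤p) =
  s≤s (≤-trans (+-mono-≤ m≤n o≤p) (≤-trans (≤-reflexive (+-comm n p)) (+-monoʳ-≤ p (m≤m*n n (suc p)))))

module _ {n m : ℕ} where

  torusDist-step : ∀ (u : Fin n × Fin m) {w v} → Adj (Torus n m) w v → torusDist u v ≤ suc (torusDist u w)
  torusDist-step (a , b) {c , d} {c′ , .d} (inj₁ (c~c′ , refl)) = +-monoˡ-≤ (cycDist b d) (cycDist-step a c~c′)
  torusDist-step (a , b) {c , d} {.c , d′} (inj₂ (refl , d~d′)) =
    subst (cycDist a c + cycDist b d′ ≤_) (+-suc (cycDist a c) (cycDist b d))
      (+-monoʳ-≤ (cycDist a c) (cycDist-step b d~d′))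

  torusDist-parent : ∀ (u v : Fin n × Fin m) k → torusDist u v ≡ suc k →
    ∃[ w ] Adj (Torus n m) w v × torusDist u w ≡ k
  torusDist-parent (a , b) (c , d) k t≡1+k with cycDist b d in db
  ... | suc k₂ with cycDist-parent b d k₂ db
  ...   | d′ , d′~d , refl = (c , d′) , inj₂ (refl , d′~d) , suc-injective (trans (sym (+-suc _ _)) t≡1+k)
  torusDist-parent (a , b) (c , d) k t≡1+k | zero with cycDist-parent a c k (trans (sym (+-identityʳ _)) t≡1+k)
  ...   | c′ , c′~c , refl = (c′ , d) , inj₁ (c′~c , refl) , trans (cong (_ +_) db) (+-identityʳ _)

  torusDist≡0⇒≡ : ∀ (u v : Fin n × Fin m) → torusDist u v ≡ 0 → u ≡ v
  torusDist≡0⇒≡ (a , b) (c , d) t≡0 =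
    cong₂ _,_ (cycDist≡0⇒≡ a c (m+n≡0⇒m≡0 _ t≡0)) (cycDist≡0⇒≡ b d (m+n≡0⇒n≡0 (cycDist a c) t≡0))

  torusDist< : ∀ (u v : Fin n × Fin m) → torusDist u v < length (verts (Torus n m))
  torusDist< (a , b) (c , d) = subst (torusDist (a , b) (c , d) <_) (sym |V|≡n*m)
    (m<n⇒o<p⇒m+o<n*p (cycDist< a c) (cycDist< b d))
    where
      |V|≡n*m : length (verts (Torus n m)) ≡ n * m
      |V|≡n*m = trans (length-cartesianProduct (allFin n) (allFin m))
        (cong₂ _*_ (List.length-tabulate {n = n} (λ i → i)) (List.length-tabulate {n = m} (λ i → i)))

  dist-torus : ∀ (u v : Fin n × Fin m) → dist (Torus n m) u v ≡ torusDist u v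
  dist-torus u = dist≡label (Torus n m) u (torusDist u) (torusDist≡0⇒≡ u) (torusDist-self u)
    (torusDist-step u) (torusDist-parent u) (torusDist< u)
    where
      torusDist-self : ∀ (u : Fin n × Fin m) → torusDist u u ≡ 0
      torusDist-self (a , b) = cong₂ _+_ (cycDist-self a) (cycDist-self b)

module _ (G : Graph) where

  Move : V G → V G → Set
  Move x y = y ≡ x ⊎ Adj G x y

  DistLipschitz : Set
  DistLipschitz = ∀ b {x y} → Adj G x y → dist G y b ≤ suc (dist G x b) × dist G x b ≤ suc (dist G y b)

  record ThreeNeighbours (x : V G) : Set where
    field
      y₁ y₂ y₃ : V G
      x~y₁ : Adj G x y₁
      x~y₂ : Adj G x y₂
      x~y₃ : Adj G x y₃
      x≢y₁ : x ≢ y₁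
      x≢y₂ : x ≢ y₂
      x≢y₃ : x ≢ y₃
      y₁≢y₂ : y₁ ≢ y₂
      y₁≢y₃ : y₁ ≢ y₃
      y₂≢y₃ : y₂ ≢ y₃

  record Twins (x b : V G) : Set where
    field
      u w : V G
      x→u : Move x u
      x→w : Move x w
      u≢w : u ≢ w
      same-dist : dist G w b ≡ dist G u b

data Offset (D v : ℕ) : Set where
  below : D ≡ suc v → Offset D v
  level : v ≡ D → Offset D v
  above : v ≡ suc D → Offset D v

offset : ∀ {D v} → v ≤ suc D → D ≤ suc v → Offset D v
offset {D} {v} v≤1+D D≤1+v with <-cmp v D
... | tri< v<D _ _ = below (≤-antisym D≤1+v v<D)
... | tri≈ _ v≡D _ = level v≡D
... | tri> _ _ D<v = above (≤-antisym v≤1+D D<v)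

module _ {G : Graph} (lipschitz : DistLipschitz G) where

  -- x and its three neighbours are four vertices whose distances to b take
  -- at most the three values D - 1, D, D + 1.
  twins : ∀ {x} → ThreeNeighbours G x → ∀ b → Twins G x b
  twins {x} N b = pigeonhole (offsetOf x~y₁) (offsetOf x~y₂) (offsetOf x~y₃)
    where
      open ThreeNeighbours N
      D : ℕ
      D = dist G x b
      offsetOf : ∀ {y} → Adj G x y → Offset D (dist G y b)
      offsetOf x~y = offset (proj₁ (lipschitz b x~y)) (proj₂ (lipschitz b x~y))
      stay : ∀ {y} → Adj G x y → x ≢ y → dist G y b ≡ D → Twins G x b
      stay x~y x≢y e = record
        { u = x ; w = _ ; x→u = inj₁ refl ; x→w = inj₂ x~y ; u≢w = x≢y ; same-dist = e }
      split : ∀ {y y′} → Adj G x y → Adj G x y′ → y ≢ y′ → dist G y′ b ≡ dist G y b → Twins G x b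
      split x~y x~y′ y≢y′ e = record
        { u = _ ; w = _ ; x→u = inj₂ x~y ; x→w = inj₂ x~y′ ; u≢w = y≢y′ ; same-dist = e }
      pigeonhole : Offset D (dist G y₁ b) → Offset D (dist G y₂ b) → Offset D (dist G y₃ b) → Twins G x b
      pigeonhole (level e) _ _ = stay x~y₁ x≢y₁ e
      pigeonhole _ (level e) _ = stay x~y₂ x≢y₂ e
      pigeonhole _ _ (level e) = stay x~y₃ x≢y₃ e
      pigeonhole (above e₁) (above e₂) _ = split x~y₁ x~y₂ y₁≢y₂ (trans e₂ (sym e₁))
      pigeonhole (below e₁) (below e₂) _ = split x~y₁ x~y₂ y₁≢y₂ (suc-injective (trans (sym e₂) e₁))
      pigeonhole (above e₁) _ (above e₃) = split x~y₁ x~y₃ y₁≢y₃ (trans e₃ (sym e₁))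
      pigeonhole (below e₁) _ (below e₃) = split x~y₁ x~y₃ y₁≢y₃ (suc-injective (trans (sym e₃) e₁))
      pigeonhole _ (above e₂) (above e₃) = split x~y₂ x~y₃ y₂≢y₃ (trans e₃ (sym e₂))
      pigeonhole _ (below e₂) (below e₃) = split x~y₂ x~y₃ y₂≢y₃ (suc-injective (trans (sym e₃) e₂))

history-cong : ∀ (G : Graph) {k} (σ : Strategy G k) (r r′ : ℕ → V G) t →
  (∀ s → s < t → r s ≡ r′ s) → history G σ r t ≡ history G σ r′ t
history-cong G σ r r′ zero    r≡r′ = refl
history-cong G σ r r′ (suc t) r≡r′
  rewrite history-cong G σ r r′ t (λ s s<t → r≡r′ s (<-trans s<t (n<1+n t))) | r≡r′ t (n<1+n t) = refl

module Evasion {G : Graph} (lipschitz : DistLipschitz G) (fan : ∀ x → ThreeNeighbours G x)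
               (x₀ : V G) (σ : Strategy G 1) where

  -- The Robber's position before turn t and the answers received before turn t.
  State : Set
  State = V G × List (Vec ℕ 1)

  twinsAt : (s : State) → Twins G (proj₁ s) (head (σ (proj₂ s)))
  twinsAt (x , H) = twins lipschitz (fan x) (head (σ H))

  state : ℕ → State
  position decoy : ℕ → V G

  state zero    = x₀ , []
  state (suc t) = position t , Vec.map (dist G (position t)) (σ (proj₂ (state t))) ∷ proj₂ (state t)

  position t = Twins.u (twinsAt (state t))
  decoy    t = Twins.w (twinsAt (state t))

  history≡answers : ∀ t → history G σ position t ≡ proj₂ (state t)
  history≡answers zero    = refl
  history≡answers (suc t) rewrite history≡answers t = refl

  robber : Trajectory G
  robber = position , λ t → Twins.x→u (twinsAt (state (suc t)))

  impostor : ℕ → ℕ → V G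
  impostor t s with s <? t
  ... | yes _ = position s
  ... | no  _ = decoy t

  impostor-moves : ∀ t s → Move G (impostor t s) (impostor t (suc s))
  impostor-moves t s with s <? t | suc s <? t
  ... | yes _   | yes _    = Twins.x→u (twinsAt (state (suc s)))
  ... | yes s<t | no  s+1≮t with ≤-antisym s<t (≮⇒≥ s+1≮t)
  ...   | refl = Twins.x→w (twinsAt (state (suc s)))
  impostor-moves t s | no s≮t | yes s+1<t = contradiction (<-trans (n<1+n s) s+1<t) s≮t
  impostor-moves t s | no _   | no _      = inj₁ refl

  impostor-before : ∀ t s → s < t → position s ≡ impostor t s
  impostor-before t s s<t with s <? t
  ... | yes _   = refl
  ... | no  s≮t = contradiction s<t s≮t

  impostor-at : ∀ t → impostor t t ≡ decoy t
  impostor-at t with t <? t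
  ... | yes t<t = contradiction t<t (<-irrefl refl)
  ... | no  _   = refl

  robber-unlocated : ∀ t → ¬ Located G σ robber t
  robber-unlocated t located = Twins.u≢w (twinsAt (state t)) (sym (trans (sym (impostor-at t))
    (located (impostor t , impostor-moves t) same-history)))
    where
      same-history : history G σ (impostor t) (suc t) ≡ history G σ position (suc t)
      same-history
        rewrite sym (history-cong G σ position (impostor t) t (impostor-before t))
              | history≡answers t | impostor-at t
        with σ (proj₂ (state t)) | Twins.same-dist (twinsAt (state t))
      ... | b ∷ [] | e = cong (λ d → (d ∷ []) ∷ proj₂ (state t)) e

one-cop-loses : ∀ (G : Graph) → V G → DistLipschitz G → (∀ x → ThreeNeighbours G x) → ¬ CopWins G 1
one-cop-loses G x₀ lipschitz fan (σ , wins) with wins (Evasion.robber lipschitz fan x₀ σ)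
... | t , located = Evasion.robber-unlocated lipschitz fan x₀ σ t located

next : ∀ {k} → Fin (suc k) → Fin (suc k)
next {k} i with suc (toℕ i) <? suc k
... | yes i<k = fromℕ< i<k
... | no  _   = zero

data NextView {k} (i : Fin (suc k)) : Fin (suc k) → Set where
  inside : ∀ {j} → toℕ i < k → toℕ j ≡ suc (toℕ i) → NextView i j
  wraps : ∀ {j} → toℕ i ≡ k → toℕ j ≡ 0 → NextView i j

nextView : ∀ {k} (i : Fin (suc k)) → NextView i (next i)
nextView {k} i with suc (toℕ i) <? suc k
... | yes i<k = inside (≤-pred i<k) (toℕ-fromℕ< i<k)
... | no  i≮k = wraps (≤-antisym (≤-pred (toℕ<n i)) (≤-pred (≮⇒≥ i≮k))) refl

toℕ-next : ∀ {k} {i : Fin (suc k)} → toℕ i < k → toℕ (next i) ≡ suc (toℕ i)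
toℕ-next {i = i} i<k with nextView i
... | inside _ e   = e
... | wraps i≡k _ = contradiction i≡k (<⇒≢ i<k)

next-CSucc : ∀ {k} (i : Fin (suc k)) → CSucc (suc k) i (next i)
next-CSucc i with nextView i
... | inside _ e    = inj₁ (sym e)
... | wraps i≡k e  = inj₂ (cong suc i≡k , e)

CSucc⇒≡next : ∀ {k} {i j : Fin (suc k)} → CSucc (suc k) i j → j ≡ next i
CSucc⇒≡next {k} {i} {j} i→j with nextView i | i→j
... | inside _ e   | inj₁ e′        = toℕ-injective (trans (sym e′) (sym e))
... | inside i<k _ | inj₂ (e′ , _)  = contradiction (suc-injective e′) (<⇒≢ i<k)
... | wraps i≡k _ | inj₁ e′        = contradiction (toℕ<n j) (<-irrefl (trans (sym e′) (cong suc i≡k)))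
... | wraps _ e   | inj₂ (_ , e′)  = toℕ-injective (trans e′ (sym e))

next-injective : ∀ {k} {i j : Fin (suc k)} → next i ≡ next j → i ≡ j
next-injective {k} {i} {j} e with nextView i | nextView j
... | inside _ a | inside _ b = toℕ-injective (suc-injective (trans (sym a) (trans (cong toℕ e) b)))
... | inside _ a | wraps _ b with () ← trans (sym a) (trans (cong toℕ e) b)
... | wraps _ a | inside _ b with () ← trans (sym b) (trans (cong toℕ (sym e)) a)
... | wraps a _ | wraps b _ = toℕ-injective (trans a (sym b))

private
  -- Here the arcs from 0 to next i and from i to j = k are complementary.
  cycDist-next-wrap : ∀ {k} {i j : Fin (suc k)} → toℕ i < k → toℕ (next i) ≡ suc (toℕ i) →
    toℕ j ≡ k → toℕ (next j) ≡ 0 → cycDist (next i) (next j) ≡ cycDist i j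
  cycDist-next-wrap {k} {i} {j} i<k a b b₀ = begin
    arc (suc k) ∣ toℕ (next i) - toℕ (next j) ∣  ≡⟨ cong₂ (λ x y → arc (suc k) ∣ x - y ∣) a b₀ ⟩
    arc (suc k) (suc x)                         ≡⟨ cong (arc (suc k)) complement ⟨
    arc (suc k) (suc k ∸ (k ∸ x))               ≡⟨ arc-complement (suc k) (m≤n⇒m≤1+n (m∸n≤m k x)) ⟩
    arc (suc k) (k ∸ x)                         ≡⟨ cong (arc (suc k)) (m≤n⇒∣m-n∣≡n∸m (<⇒≤ i<k)) ⟨
    arc (suc k) ∣ x - k ∣                       ≡⟨ cong (λ y → arc (suc k) ∣ x - y ∣) b ⟨
    arc (suc k) ∣ x - toℕ j ∣                   ∎
    where
      x : ℕ
      x = toℕ i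
      complement : suc k ∸ (k ∸ x) ≡ suc x
      complement = trans (+-∸-assoc 1 (m∸n≤m k x)) (cong suc (m∸[m∸n]≡n (<⇒≤ i<k)))

cycDist-next : ∀ {k} (i j : Fin (suc k)) → cycDist (next i) (next j) ≡ cycDist i j
cycDist-next {k} i j with nextView i | nextView j
... | inside _ a   | inside _ b   = cong₂ (λ x y → arc (suc k) ∣ x - y ∣) a b
... | inside i<k a | wraps b b₀  = cycDist-next-wrap i<k a b b₀
... | wraps a a₀  | inside j<k b =
  trans (cycDist-sym (next i) (next j)) (trans (cycDist-next-wrap j<k b a a₀) (cycDist-sym j i))
... | wraps a _   | wraps b _ with toℕ-injective {i = i} {j} (trans a (sym b))
...   | refl = trans (cycDist-self (next i)) (sym (cycDist-self i))

rotate : ∀ {k} → ℕ → Fin (suc k) → Fin (suc k)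
rotate zero    i = i
rotate (suc x) i = next (rotate x i)

rotate-next : ∀ {k} x (i : Fin (suc k)) → rotate x (next i) ≡ next (rotate x i)
rotate-next zero    i = refl
rotate-next (suc x) i = cong next (rotate-next x i)

rotate-zero : ∀ {k} (a : Fin (suc k)) → rotate (toℕ a) zero ≡ a
rotate-zero {k} a = toℕ-injective (toℕ-rotate (toℕ a) (toℕ<n a))
  where
    toℕ-rotate : ∀ x → x < suc k → toℕ (rotate {k} x zero) ≡ x
    toℕ-rotate zero    _       = refl
    toℕ-rotate (suc x) 1+x<1+k with nextView (rotate {k} x zero)
    ... | inside _ e = trans e (cong suc (toℕ-rotate x (m<n⇒m<1+n (≤-pred 1+x<1+k))))
    ... | wraps e _ = contradiction (≤-pred 1+x<1+k)
                       (<-irrefl (trans (sym (toℕ-rotate x (m<n⇒m<1+n (≤-pred 1+x<1+k)))) e))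

cycDist-rotate : ∀ {k} x (i j : Fin (suc k)) → cycDist (rotate x i) (rotate x j) ≡ cycDist i j
cycDist-rotate zero    i j = refl
cycDist-rotate (suc x) i j = trans (cycDist-next (rotate x i) (rotate x j)) (cycDist-rotate x i j)

prev : ∀ {k} → Fin (suc k) → Fin (suc k)
prev {k} zero = fromℕ k
prev (suc j)  = inject₁ j

prev-CSucc : ∀ {k} (i : Fin (suc k)) → CSucc (suc k) (prev i) i
prev-CSucc {k} zero = inj₂ (cong suc (toℕ-fromℕ k) , refl)
prev-CSucc (suc j)  = inj₁ (cong suc (toℕ-inject₁ j))

next-prev : ∀ {k} (i : Fin (suc k)) → next (prev i) ≡ i
next-prev i = sym (CSucc⇒≡next (prev-CSucc i))

next≢ : ∀ {k} (i : Fin (suc (suc k))) → i ≢ next i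
next≢ i e with nextView i
... | inside _ a = <-irrefl (trans (cong toℕ e) a) (n<1+n (toℕ i))
... | wraps a a₀ with () ← trans (sym a) (trans (cong toℕ e) a₀)

prev≢ : ∀ {k} (i : Fin (suc (suc k))) → i ≢ prev i
prev≢ i e = next≢ i (sym (trans (cong next e) (next-prev i)))

next≢prev : ∀ {k} (i : Fin (suc (suc (suc k)))) → next i ≢ prev i
next≢prev i e = next²≢ (trans (cong next e) (next-prev i))
  where
    next²≢ : next (next i) ≢ i
    next²≢ e² with nextView i | nextView (next i)
    ... | inside _ a | inside _ b = <-irrefl (trans (cong toℕ (sym e²)) (trans b (cong suc a))) (<-trans (n<1+n _) (n<1+n _))
    ... | inside _ a | wraps b b₀ with () ← trans (sym b) (trans a (cong suc (trans (sym (cong toℕ e²)) b₀)))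
    ... | wraps a a₀ | inside _ b with () ← trans (sym a) (trans (sym (cong toℕ e²)) (trans b (cong suc a₀)))
    ... | wraps _ a₀ | wraps b _ with () ← trans (sym b) a₀


torusDist-sym : ∀ {n m} (u v : Fin n × Fin m) → torusDist u v ≡ torusDist v u
torusDist-sym (a , b) (c , d) = cong₂ _+_ (cycDist-sym a c) (cycDist-sym b d)

torus-Adj-sym : ∀ {n m} {u v : Fin n × Fin m} → Adj (Torus n m) u v → Adj (Torus n m) v u
torus-Adj-sym (inj₁ (a~c , refl)) = inj₁ (Sum.swap a~c , refl)
torus-Adj-sym (inj₂ (refl , b~d)) = inj₂ (refl , Sum.swap b~d)

torus-DistLipschitz : ∀ n m → DistLipschitz (Torus n m)
torus-DistLipschitz n m b x~y = dist-step x~y , dist-step (torus-Adj-sym x~y)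
  where
    dist-step : ∀ {x y} → Adj (Torus n m) x y → dist (Torus n m) y b ≤ suc (dist (Torus n m) x b)
    dist-step {x} {y} x~y = subst₂ (λ d d′ → d ≤ suc d′)
      (sym (trans (dist-torus y b) (torusDist-sym y b))) (sym (trans (dist-torus x b) (torusDist-sym x b)))
      (torusDist-step b x~y)

torus-ThreeNeighbours : ∀ n m (x : Fin (2 + n) × Fin (3 + m)) → ThreeNeighbours (Torus (2 + n) (3 + m)) x
torus-ThreeNeighbours n m (a , b) = record
  { y₁ = next a , b
  ; y₂ = a , next b
  ; y₃ = a , prev b
  ; x~y₁ = inj₁ (inj₁ (next-CSucc a) , refl)
  ; x~y₂ = inj₂ (refl , inj₁ (next-CSucc b))
  ; x~y₃ = inj₂ (refl , inj₂ (prev-CSucc b))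
  ; x≢y₁ = λ e → next≢ a (cong proj₁ e)
  ; x≢y₂ = λ e → next≢ b (cong proj₂ e)
  ; x≢y₃ = λ e → prev≢ b (cong proj₂ e)
  ; y₁≢y₂ = λ e → next≢ a (sym (cong proj₁ e))
  ; y₁≢y₃ = λ e → next≢ a (sym (cong proj₁ e))
  ; y₂≢y₃ = λ e → next≢prev b (cong proj₂ e)
  }

torus-one-cop-loses : ∀ {n m} → 2 ≤ n → 3 ≤ m → ¬ CopWins (Torus n m) 1
torus-one-cop-loses {suc (suc n)} {suc (suc (suc m))} (s≤s (s≤s z≤n)) (s≤s (s≤s (s≤s z≤n))) =
  one-cop-loses (Torus (2 + n) (3 + m)) (zero , zero) (torus-DistLipschitz _ _) (torus-ThreeNeighbours n m)

+-double-cancel : ∀ s {β β′} → s + 2 * β ≡ s + 2 * β′ → β ≡ β′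
+-double-cancel s {β} {β′} e = *-cancelˡ-≡ β β′ 2 (+-cancelˡ-≡ s _ _ e)

+-double-parity : ∀ s β β′ → s + 2 * β ≢ suc s + 2 * β′
+-double-parity s β β′ e = even≢odd β β′ (+-cancelˡ-≡ s _ _ (trans e (sym (+-suc s _))))

+-double : ∀ a c β → (a + β) + (c + β) ≡ (a + c) + 2 * β
+-double = solve-∀

module OddCycle (p : ℕ) where

  n : ℕ
  n = suc (2 * p)

  2p≡p+p : 2 * p ≡ p + p
  2p≡p+p = cong (p +_) (+-identityʳ p)

  n∸p : n ∸ p ≡ suc p
  n∸p = trans (cong (λ m → suc m ∸ p) 2p≡p+p) (trans (+-∸-assoc 1 (m≤m+n p p)) (cong suc (m+n∸m≡n p p)))

  arc-short-side : ∀ {x} → x ≤ p → arc n x ≡ x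
  arc-short-side {x} x≤p =
    arc-short n (≤-trans x≤p (≤-trans (n≤1+n p) (subst (_≤ n ∸ x) n∸p (∸-monoʳ-≤ n x≤p))))

  arc-1+p : arc n (suc p) ≡ p
  arc-1+p = trans (cong (arc n) (sym n∸p))
    (trans (arc-complement n (m≤n⇒m≤1+n (m≤m+n p (p + 0)))) (arc-short-side ≤-refl))

  ∣x-p∣+p : ∀ {x} → p ≤ x → ∣ x - p ∣ + p ≡ x
  ∣x-p∣+p p≤x = trans (cong (_+ p) (m≤n⇒∣n-m∣≡n∸m p≤x)) (m∸n+n≡m p≤x)

  side-sum-short : ∀ {x} → x ≤ p → arc n x + ∣ x - p ∣ ≡ p
  side-sum-short {x} x≤p = begin
    arc n x + ∣ x - p ∣  ≡⟨ cong₂ _+_ (arc-short-side x≤p) (m≤n⇒∣m-n∣≡n∸m x≤p) ⟩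
    x + (p ∸ x)          ≡⟨ m+[n∸m]≡n x≤p ⟩
    p                    ∎

  side-sum-long : ∀ {x} → p < x → x ≤ 2 * p → arc n x + ∣ x - p ∣ ≡ suc p
  side-sum-long {x} p<x x≤2p = +-cancelʳ-≡ p _ _ (begin
    arc n x + ∣ x - p ∣ + p    ≡⟨ +-assoc (arc n x) _ p ⟩
    arc n x + (∣ x - p ∣ + p)  ≡⟨ cong₂ _+_ arc≡n∸x (∣x-p∣+p (<⇒≤ p<x)) ⟩
    (n ∸ x) + x                ≡⟨ m∸n+n≡m (m≤n⇒m≤1+n x≤2p) ⟩
    suc (2 * p)                ≡⟨ cong suc 2p≡p+p ⟩
    suc p + p                  ∎)
    where
      n∸1+p : n ∸ suc p ≡ p
      n∸1+p = trans (cong (_∸ p) 2p≡p+p) (m+n∸m≡n p p)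
      arc≡n∸x : arc n x ≡ n ∸ x
      arc≡n∸x = trans (sym (arc-complement n (m≤n⇒m≤1+n x≤2p)))
                      (arc-short-side (≤-trans (∸-monoʳ-≤ n p<x) (≤-reflexive n∸1+p)))

  side-sum : ∀ {x} → x ≤ 2 * p →
    (x ≤ p × arc n x + ∣ x - p ∣ ≡ p) ⊎ (p < x × arc n x + ∣ x - p ∣ ≡ suc p)
  side-sum {x} x≤2p with x ≤? p
  ... | yes x≤p = inj₁ (x≤p , side-sum-short x≤p)
  ... | no  x≰p = inj₂ (≰⇒> x≰p , side-sum-long (≰⇒> x≰p) x≤2p)

  resolving : ∀ {x x′} → x ≤ 2 * p → x′ ≤ 2 * p → arc n x ≡ arc n x′ → ∣ x - p ∣ ≡ ∣ x′ - p ∣ → x ≡ x′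
  resolving {x} {x′} x≤2p x′≤2p arc≡ ∣∣≡ with side-sum x≤2p | side-sum x′≤2p
  ... | inj₁ (x≤p , _) | inj₁ (x′≤p , _) = trans (sym (arc-short-side x≤p)) (trans arc≡ (arc-short-side x′≤p))
  ... | inj₂ (p<x , _) | inj₂ (p<x′ , _) =
    trans (sym (∣x-p∣+p (<⇒≤ p<x))) (trans (cong (_+ p) ∣∣≡) (∣x-p∣+p (<⇒≤ p<x′)))
  ... | inj₁ (_ , s) | inj₂ (_ , s′) =
    contradiction (trans (sym s) (trans (cong₂ _+_ arc≡ ∣∣≡) s′)) (1+n≢n ∘ sym)
  ... | inj₂ (_ , s) | inj₁ (_ , s′) =
    contradiction (trans (sym s′) (trans (cong₂ _+_ (sym arc≡) (sym ∣∣≡)) s)) (1+n≢n ∘ sym)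

  decode : ∀ {x x′ β β′} → x ≤ 2 * p → x′ ≤ 2 * p →
    arc n x + β ≡ arc n x′ + β′ → ∣ x - p ∣ + β ≡ ∣ x′ - p ∣ + β′ → x ≡ x′ × β ≡ β′
  decode {x} {x′} {β} {β′} x≤2p x′≤2p e₁ e₂ =
    resolving x≤2p x′≤2p (+-cancelʳ-≡ β _ _ (trans e₁ (cong (arc n x′ +_) (sym β≡β′))))
                         (+-cancelʳ-≡ β _ _ (trans e₂ (cong (∣ x′ - p ∣ +_) (sym β≡β′)))) ,
    β≡β′
    where
      total : (arc n x + ∣ x - p ∣) + 2 * β ≡ (arc n x′ + ∣ x′ - p ∣) + 2 * β′
      total = trans (sym (+-double (arc n x) _ β)) (trans (cong₂ _+_ e₁ e₂) (+-double (arc n x′) _ β′))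
      total′ : ∀ {a a′} → arc n x + ∣ x - p ∣ ≡ a → arc n x′ + ∣ x′ - p ∣ ≡ a′ → a + 2 * β ≡ a′ + 2 * β′
      total′ s s′ = subst₂ (λ a a′ → a + 2 * β ≡ a′ + 2 * β′) s s′ total
      β≡β′ : β ≡ β′
      β≡β′ with side-sum x≤2p | side-sum x′≤2p
      ... | inj₁ (_ , s) | inj₁ (_ , s′) = +-double-cancel p (total′ s s′)
      ... | inj₂ (_ , s) | inj₂ (_ , s′) = +-double-cancel (suc p) (total′ s s′)
      ... | inj₁ (_ , s) | inj₂ (_ , s′) = contradiction (total′ s s′) (+-double-parity p β β′)
      ... | inj₂ (_ , s) | inj₁ (_ , s′) = contradiction (sym (total′ s s′)) (+-double-parity p β′ β)

  P : Fin n
  P = fromℕ< (s≤s (m≤m+n p (p + 0)))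

  toℕ-P : toℕ P ≡ p
  toℕ-P = toℕ-fromℕ< (s≤s (m≤m+n p (p + 0)))

  ∣x-p∣≤p : ∀ {x} → x ≤ 2 * p → ∣ x - p ∣ ≤ p
  ∣x-p∣≤p {x} x≤2p with ∣m-n∣≡[m∸n]∨[n∸m] x p
  ... | inj₁ e = subst (_≤ p) (sym e) (m≤n+o⇒m∸n≤o x p (subst (x ≤_) 2p≡p+p x≤2p))
  ... | inj₂ e = subst (_≤ p) (sym e) (m∸n≤m p x)

  cycDist-P : ∀ (a : Fin n) → cycDist a P ≡ ∣ toℕ a - p ∣
  cycDist-P a = trans (cong (λ y → arc n ∣ toℕ a - y ∣) toℕ-P) (arc-short-side (∣x-p∣≤p (≤-pred (toℕ<n a))))

  -- In the torus, β is the row part of the distance.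
  decode-columns : ∀ (a a′ : Fin n) {β β′} → cycDist a zero + β ≡ cycDist a′ zero + β′ →
    cycDist a P + β ≡ cycDist a′ P + β′ → a ≡ a′ × β ≡ β′
  decode-columns a a′ e₁ e₂ with decode (≤-pred (toℕ<n a)) (≤-pred (toℕ<n a′))
    (subst₂ (λ x x′ → arc n x + _ ≡ arc n x′ + _) (∣-∣-identityʳ (toℕ a)) (∣-∣-identityʳ (toℕ a′)) e₁)
    (subst₂ (λ x x′ → x + _ ≡ x′ + _) (cycDist-P a) (cycDist-P a′) e₂)
  ... | a≡a′ , β≡β′ = toℕ-injective a≡a′ , β≡β′

data ColumnStep : Set where
  stay forward backward : ColumnStep

_≟ˢ_ : DecidableEquality ColumnStep
stay     ≟ˢ stay     = yes refl
forward  ≟ˢ forward  = yes refl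
backward ≟ˢ backward = yes refl
stay     ≟ˢ forward  = no λ ()
stay     ≟ˢ backward = no λ ()
forward  ≟ˢ stay     = no λ ()
forward  ≟ˢ backward = no λ ()
backward ≟ˢ stay     = no λ ()
backward ≟ˢ forward  = no λ ()

all-steps? : {P : ColumnStep → Set} → (∀ s → Dec (P s)) → Dec (∀ s → P s)
all-steps? P? with P? stay | P? forward | P? backward
... | yes s | yes f | yes b = yes λ { stay → s ; forward → f ; backward → b }
... | no ¬s | _     | _     = no λ all → ¬s (all stay)
... | yes _ | no ¬f | _     = no λ all → ¬f (all forward)
... | yes _ | yes _ | no ¬b = no λ all → ¬b (all backward)

column : ∀ {k} → ColumnStep → Fin (suc k)
column stay     = zero
column forward  = next zero
column backward = prev zero

-- On C (2p + 1) with P = p, the distances from column K to P and to next P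
-- are p - 1 plus these.
excess₁ excess₂ : ColumnStep → ℕ
excess₁ stay     = 1
excess₁ forward  = 0
excess₁ backward = 1
excess₂ stay     = 1
excess₂ forward  = 1
excess₂ backward = 0

RowStep : ∀ {m} → ColumnStep → Fin m → Fin m → Set
RowStep {m} stay b b′ = Move (Cycle m) b b′
RowStep forward  b b′ = b′ ≡ b
RowStep backward b b′ = b′ ≡ b

RowStep? : ∀ {m} K (b b′ : Fin m) → Dec (RowStep K b b′)
RowStep? {m} stay b b′ = (b′ ≟ᶠ b) ⊎-dec adj? (Cycle m) b b′
RowStep? forward  b b′ = b′ ≟ᶠ b
RowStep? backward b b′ = b′ ≟ᶠ b

-- Knowing the row distance of the Robber's previous vertex from row 0, the
-- answers of probes in rows 0 and 1 determine its column step and new row.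
SecondRoundResolves : ℕ → Set
SecondRoundResolves m = ∀ K K′ (b₀ b₁ b₀′ b₁′ : Fin (suc m)) → RowStep K b₀ b₁ → RowStep K′ b₀′ b₁′ →
  cycDist b₀ zero ≡ cycDist b₀′ zero →
  excess₁ K + cycDist b₁ zero ≡ excess₁ K′ + cycDist b₁′ zero →
  excess₂ K + cycDist b₁ (next zero) ≡ excess₂ K′ + cycDist b₁′ (next zero) →
  K ≡ K′ × b₁ ≡ b₁′

secondRoundResolves? : ∀ m → Dec (SecondRoundResolves m)
secondRoundResolves? m =
  all-steps? λ K → all-steps? λ K′ → all? λ b₀ → all? λ b₁ → all? λ b₀′ → all? λ b₁′ →
  RowStep? K b₀ b₁ →-dec (RowStep? K′ b₀′ b₁′ →-dec
  ((cycDist b₀ zero ≟ cycDist b₀′ zero) →-dec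
  ((excess₁ K + cycDist b₁ zero ≟ excess₁ K′ + cycDist b₁′ zero) →-dec
  ((excess₂ K + cycDist b₁ (next zero) ≟ excess₂ K′ + cycDist b₁′ (next zero)) →-dec
  ((K ≟ˢ K′) ×-dec (b₁ ≟ᶠ b₁′))))))

secondRoundResolves-C₄ : SecondRoundResolves 3
secondRoundResolves-C₄ = toWitness {a? = secondRoundResolves? 3} tt

secondRoundResolves-C₆ : SecondRoundResolves 5
secondRoundResolves-C₆ = toWitness {a? = secondRoundResolves? 5} tt

module TwoCops (p′ m′ : ℕ) (resolves : SecondRoundResolves m′) where

  open OddCycle (suc p′)

  G : Graph
  G = Torus n (suc m′)

  probes₀ : Vec (V G) 2
  probes₀ = (zero , zero) ∷ (P , zero) ∷ []

  -- (a + p , 0) and (a + p + 1 , 1) for the column a found in round zero.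
  probes₁ : ℕ → Vec (V G) 2
  probes₁ x = (rotate x P , zero) ∷ (rotate x (next P) , next zero) ∷ []

  answers : V G → Vec (V G) 2 → Vec ℕ 2
  answers u = Vec.map (dist G u)

  consistentWith : Vec ℕ 2 → V G
  consistentWith A with any? (λ u → Vec.≡-dec _≟_ (answers u probes₀) A) (verts G)
  ... | yes found = proj₁ (satisfied found)
  ... | no  _     = zero , zero

  strategy : Strategy G 2
  strategy []      = probes₀
  strategy (A ∷ _) = probes₁ (toℕ (proj₁ (consistentWith A)))

  round₀ : ∀ u u′ → answers u′ probes₀ ≡ answers u probes₀ →
    proj₁ u′ ≡ proj₁ u × cycDist (proj₂ u′) zero ≡ cycDist (proj₂ u) zero
  round₀ (a , b) (a′ , b′) same = decode-columns a′ a
    (trans (sym (dist-torus (a′ , b′) (zero , zero)))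
      (trans (Vec.∷-injectiveˡ same) (dist-torus (a , b) (zero , zero))))
    (trans (sym (dist-torus (a′ , b′) (P , zero)))
      (trans (Vec.∷-injectiveˡ (Vec.∷-injectiveʳ same)) (dist-torus (a , b) (P , zero))))

  consistentWith-column : ∀ u → proj₁ (consistentWith (answers u probes₀)) ≡ proj₁ u
  consistentWith-column u with any? (λ v → Vec.≡-dec _≟_ (answers v probes₀) (answers u probes₀)) (verts G)
  ... | yes found = proj₁ (round₀ u _ (proj₂ (satisfied found)))
  ... | no  none  = contradiction (lose (complete G u) refl) none

  private
    p : ℕ
    p = suc p′

    cycDist-via : ∀ {i j : Fin n} {x y} → toℕ i ≡ x → toℕ j ≡ y → cycDist i j ≡ arc n ∣ x - y ∣
    cycDist-via refl refl = refl

    toℕ-next-zero : toℕ (next {2 * p} zero) ≡ 1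
    toℕ-next-zero = toℕ-next {2 * p} {zero} (s≤s z≤n)

    toℕ-prev-zero : toℕ (prev {2 * p} zero) ≡ p + p
    toℕ-prev-zero = trans (toℕ-fromℕ (2 * p)) 2p≡p+p

    toℕ-next-P : toℕ (next P) ≡ suc p
    toℕ-next-P = trans (toℕ-next (subst₂ _<_ (sym toℕ-P) (sym 2p≡p+p) (m<m+n p (s≤s z≤n)))) (cong suc toℕ-P)

  cycDist-column-P : ∀ K → cycDist (column K) P ≡ p′ + excess₁ K
  cycDist-column-P stay     = trans (cycDist-via {i = zero} refl toℕ-P) (trans (arc-short-side ≤-refl) (+-comm 1 p′))
  cycDist-column-P forward  = trans (cycDist-via toℕ-next-zero toℕ-P)
    (trans (arc-short-side (n≤1+n p′)) (sym (+-identityʳ p′)))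
  cycDist-column-P backward = trans (cycDist-via toℕ-prev-zero toℕ-P)
    (trans (cong (arc n) (m≡n+o⇒∣m-n∣≡o {n = p} refl)) (trans (arc-short-side ≤-refl) (+-comm 1 p′)))

  cycDist-column-next-P : ∀ K → cycDist (column K) (next P) ≡ p′ + excess₂ K
  cycDist-column-next-P stay     = trans (cycDist-via {i = zero} refl toℕ-next-P) (trans arc-1+p (+-comm 1 p′))
  cycDist-column-next-P forward  = trans (cycDist-next zero P) (cycDist-column-P stay)
  cycDist-column-next-P backward = trans (cycDist-via toℕ-prev-zero toℕ-next-P)
    (trans (cong (arc n) (m≡n+o⇒∣m-n∣≡o (cong suc (+-suc p′ p′))))
      (trans (arc-short-side (n≤1+n p′)) (sym (+-identityʳ p′))))

  data RelativeMove (a : Fin n) (b₀ : Fin (suc m′)) : V G → Set where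
    move : ∀ K b₁ → RowStep K b₀ b₁ → RelativeMove a b₀ (rotate (toℕ a) (column K) , b₁)

  relativeMove : ∀ {a b₀ y} → Move G (a , b₀) y → RelativeMove a b₀ y
  relativeMove {a} {b₀} (inj₁ refl) =
    subst (RelativeMove a b₀) (cong (_, b₀) (rotate-zero a)) (move stay b₀ (inj₁ refl))
  relativeMove {a} {b₀} (inj₂ (inj₂ (refl , b₀~b₁))) =
    subst (RelativeMove a b₀) (cong (_, _) (rotate-zero a)) (move stay _ (inj₂ b₀~b₁))
  relativeMove {a} {b₀} {a₁ , .b₀} (inj₂ (inj₁ (inj₁ a→a₁ , refl))) =
    subst (RelativeMove a b₀) (cong (_, b₀) (begin
      rotate (toℕ a) (next zero)   ≡⟨ rotate-next (toℕ a) zero ⟩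
      next (rotate (toℕ a) zero)   ≡⟨ cong next (rotate-zero a) ⟩
      next a                       ≡⟨ CSucc⇒≡next a→a₁ ⟨
      a₁                           ∎)) (move forward b₀ refl)
  relativeMove {a} {b₀} {a₁ , .b₀} (inj₂ (inj₁ (inj₂ a₁→a , refl))) =
    subst (RelativeMove a b₀) (cong (_, b₀) (next-injective (begin
      next (rotate (toℕ a) (prev zero)) ≡⟨ rotate-next (toℕ a) (prev zero) ⟨
      rotate (toℕ a) (next (prev zero)) ≡⟨ cong (rotate (toℕ a)) (next-prev zero) ⟩
      rotate (toℕ a) zero               ≡⟨ rotate-zero a ⟩
      a                                 ≡⟨ CSucc⇒≡next a₁→a ⟩
      next a₁                           ∎))) (move backward b₀ refl)

  answers₁ : ∀ x K b → answers (rotate x (column K) , b) (probes₁ x) ≡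
    (p′ + (excess₁ K + cycDist b zero)) ∷ (p′ + (excess₂ K + cycDist b (next zero))) ∷ []
  answers₁ x K b = cong₂ (λ d d′ → d ∷ d′ ∷ [])
    (answer P zero (cycDist-column-P K)) (answer (next P) (next zero) (cycDist-column-next-P K))
    where
      answer : ∀ c r {o} → cycDist (column K) c ≡ p′ + o →
        dist G (rotate x (column K) , b) (rotate x c , r) ≡ p′ + (o + cycDist b r)
      answer c r {o} e = begin
        dist G (rotate x (column K) , b) (rotate x c , r)       ≡⟨ dist-torus (rotate x (column K) , b) (rotate x c , r) ⟩
        cycDist (rotate x (column K)) (rotate x c) + cycDist b r ≡⟨ cong (_+ cycDist b r) (trans (cycDist-rotate x _ c) e) ⟩
        p′ + o + cycDist b r                                    ≡⟨ +-assoc p′ o _ ⟩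
        p′ + (o + cycDist b r)                                  ∎

  answers₁-cancel : ∀ x K K′ b b′ →
    answers (rotate x (column K′) , b′) (probes₁ x) ≡ answers (rotate x (column K) , b) (probes₁ x) →
    excess₁ K′ + cycDist b′ zero ≡ excess₁ K + cycDist b zero ×
    excess₂ K′ + cycDist b′ (next zero) ≡ excess₂ K + cycDist b (next zero)
  answers₁-cancel x K K′ b b′ same =
    +-cancelˡ-≡ p′ _ _ (Vec.∷-injectiveˡ same′) , +-cancelˡ-≡ p′ _ _ (Vec.∷-injectiveˡ (Vec.∷-injectiveʳ same′))
    where
      same′ : (p′ + (excess₁ K′ + cycDist b′ zero)) ∷ (p′ + (excess₂ K′ + cycDist b′ (next zero))) ∷ [] ≡
              (p′ + (excess₁ K + cycDist b zero)) ∷ (p′ + (excess₂ K + cycDist b (next zero))) ∷ []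
      same′ = trans (sym (answers₁ x K′ b′)) (trans same (answers₁ x K b))

  round₁ : ∀ {a b₀ b₀′ y y′} → Move G (a , b₀) y → Move G (a , b₀′) y′ →
    cycDist b₀′ zero ≡ cycDist b₀ zero → answers y′ (probes₁ (toℕ a)) ≡ answers y (probes₁ (toℕ a)) → y′ ≡ y
  round₁ {a} a,b₀→y a,b₀′→y′ β′≡β same with relativeMove a,b₀→y | relativeMove a,b₀′→y′
  ... | move K b₁ R | move K′ b₁′ R′
    with resolves K′ K _ b₁′ _ b₁ R′ R β′≡β (proj₁ (answers₁-cancel (toℕ a) K K′ b₁ b₁′ same))
                                             (proj₂ (answers₁-cancel (toℕ a) K K′ b₁ b₁′ same))
  ... | refl , refl = refl

  strategy-round₁ : ∀ u → strategy (answers u probes₀ ∷ []) ≡ probes₁ (toℕ (proj₁ u))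
  strategy-round₁ u = cong (probes₁ ∘ toℕ) (consistentWith-column u)

  wins : (r : Trajectory G) → ∃[ t ] Located G strategy r t
  wins (r , moves) = 1 , λ (r′ , moves′) same → located r′ moves′ same
    where
      located : ∀ r′ → (∀ t → Move G (r′ t) (r′ (suc t))) →
        history G strategy r′ 2 ≡ history G strategy r 2 → r′ 1 ≡ r 1
      located r′ moves′ same =
        let a′≡a , β′≡β = round₀ (r 0) (r′ 0) (List.∷-injectiveˡ (List.∷-injectiveʳ same)) in
        round₁ (moves 0) (subst (λ a → Move G (a , proj₂ (r′ 0)) (r′ 1)) a′≡a (moves′ 0)) β′≡β (begin
        answers (r′ 1) (probes₁ (toℕ (proj₁ (r 0))))            ≡⟨ cong (answers (r′ 1) ∘ probes₁ ∘ toℕ) a′≡a ⟨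
        answers (r′ 1) (probes₁ (toℕ (proj₁ (r′ 0))))           ≡⟨ cong (answers (r′ 1)) (strategy-round₁ (r′ 0)) ⟨
        answers (r′ 1) (strategy (answers (r′ 0) probes₀ ∷ [])) ≡⟨ List.∷-injectiveˡ same ⟩
        answers (r 1) (strategy (answers (r 0) probes₀ ∷ []))   ≡⟨ cong (answers (r 1)) (strategy-round₁ (r 0)) ⟩
        answers (r 1) (probes₁ (toℕ (proj₁ (r 0))))             ∎)

two-cops-win : ∀ p′ m′ → SecondRoundResolves m′ → CopWins (Torus (suc (2 * suc p′)) (suc m′)) 2
two-cops-win p′ m′ resolves = TwoCops.strategy p′ m′ resolves , TwoCops.wins p′ m′ resolves

ζ≡2 : ∀ {G} → CopWins G 2 → ¬ CopWins G 1 → LocalizationNumberIs G 2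
ζ≡2 two-win one-loses = two-win , λ { (suc zero) _ _ → one-loses ; (suc (suc _)) _ (s≤s (s≤s ())) }

proposition5p16 : (p q : ℕ) → 1 ≤ p → (q ≡ 2 ⊎ q ≡ 3) →
    LocalizationNumberIs (Cycle (suc (2 * p)) □ Cycle (2 * q)) 2
-- The graph is given explicitly: inferring it from the arguments makes Agda
-- compare the two unfolded games, which takes very long.
proposition5p16 (suc p′) _ _ (inj₁ refl) =
  ζ≡2 {Cycle (suc (2 * suc p′)) □ Cycle (2 * 2)}
    (two-cops-win p′ 3 secondRoundResolves-C₄) (torus-one-cop-loses (s≤s (s≤s z≤n)) (s≤s (s≤s (s≤s z≤n))))
proposition5p16 (suc p′) _ _ (inj₂ refl) =
  ζ≡2 {Cycle (suc (2 * suc p′)) □ Cycle (2 * 3)}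
    (two-cops-win p′ 5 secondRoundResolves-C₆) (torus-one-cop-loses (s≤s (s≤s z≤n)) (s≤s (s≤s (s≤s z≤n))))
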